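{- Let $\mathcal{T}$ be a planar tiling with symmetry group $G$, let $O$ be a subset of (the set of tiles of) $\mathcal{T}$, and let $H$ be a subgroup of $G$ such that $O$ is a union of $H$-orbits $X_1,\ldots,X_n$. Suppose that in a given coloring of $O$ all the $H$-orbits $X_1,\ldots,X_n$ have the same set of $m$ colors. Then the colors of $O$ are permuted by the elements of $H$ if and only if the coloring corresponds to a partition of $O$ (into color classes) of the form $$\{h(Jt_1\cup\cdots\cup Jt_n)\mid h\in H\},$$ where $t_i\in X_i$ for $1\leq i\leq n$, and $J$ is a subgroup of index $m$ in $H$ that contains $\mathrm{stab}_H(t_1),\ldots,\mathrm{stab}_H(t_n)$.
   Context: A planar tiling is a covering of the plane (spherical, Euclidean or hyperbolic) by tiles without gaps or overlaps; its symmetry group $G$ is the group of isometries mapping the tiling to itself. For a tile $t$ and subgroup $K\le G$, $Kt=\{kt:k\in K\}$, and the $H$-orbits are the sets $Ht$. $\mathrm{stab}_H(t)=\{h\in H: ht=t\}$. A coloring is a surjective map from the set of tiles to a finite set of colors; it corresponds to the partition of the tiles into color classes. The colors are permuted by $h$ if for every color $c$, $h$ maps all tiles of color $c$ to tiles of a single color, and the induced map on colors is a permutation. -}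

module Defs where

open import Level using (0ℓ; Level; _⊔_)
open import Algebra.Bundles using (Group)
open import Data.Nat using (ℕ)
open import Data.Fin using (Fin)
open import Data.Product using (Σ; ∃; _×_; _,_)
open import Relation.Binary.PropositionalEquality using (_≡_; _≢_)
open import Relation.Nullary using (¬_)
open import Function.Definitions using (Bijective)

_⟺_ : {a b : Level} → Set a → Set b → Set (a ⊔ b)
A ⟺ B = (A → B) × (B → A)

-- a (left) action of the group H on the set T of tiles
-- (in the paper: H ≤ G = symmetry group of the tiling, acting on tiles)
record Action (H : Group 0ℓ 0ℓ) (T : Set) : Set where
  open Group H
  field
    act   : Carrier → T → T
    act-ε : ∀ t → act ε t ≡ t
    act-∙ : ∀ g h t → act (g ∙ h) t ≡ act g (act h t)
    act-≈ : ∀ {g h} t → g ≈ h → act g t ≡ act h t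

module _ (H : Group 0ℓ 0ℓ) where
  open Group H

  record IsSubgroup (J : Carrier → Set) : Set where
    field
      resp  : ∀ {g h} → g ≈ h → J g → J h
      ε∈    : J ε
      ∙∈    : ∀ {g h} → J g → J h → J (g ∙ h)
      ⁻¹∈   : ∀ {g} → J g → J (g ⁻¹)

  -- J has index m in H: there are m left cosets r i J, i : Fin m,
  -- covering H and pairwise distinct
  HasIndex : (Carrier → Set) → ℕ → Set
  HasIndex J m =
    Σ (Fin m → Carrier) λ r →
      (∀ h → ∃ λ i → J (r i ⁻¹ ∙ h)) ×
      (∀ i j → J (r i ⁻¹ ∙ r j) → i ≡ j)

  module _ {T : Set} (A : Action H T) where
    open Action A

    StabIn : T → (Carrier → Set) → Set
    StabIn t J = ∀ g → act g t ≡ t → J g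

    IsOrbit : (T → Set) → Set
    IsOrbit X = ∃ λ t → ∀ s → X s ⟺ (∃ λ h → act h t ≡ s)

    ColorsPermutedBy : {m : ℕ} → (T → Set) → (T → Fin m) → Carrier → Set
    ColorsPermutedBy {m} O col h =
      Σ (Fin m → Fin m) λ π →
        (∀ t → O t → col (act h t) ≡ π (col t)) × Bijective _≡_ _≡_ π

    Block : {n : ℕ} → (Carrier → Set) → (Fin n → T) → Carrier → T → Set
    Block J t h s = ∃ λ i → ∃ λ j → J j × act (h ∙ j) (t i) ≡ s

    ColorClass : {m : ℕ} → (T → Set) → (T → Fin m) → Fin m → T → Set
    ColorClass O col k s = O s × col s ≡ k

    PartitionIsBlocks : {n m : ℕ} → (T → Set) → (T → Fin m) →
                        (Carrier → Set) → (Fin n → T) → Set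
    PartitionIsBlocks O col J t =
      (∀ k → ∃ λ h → ∀ s → ColorClass O col k s ⟺ Block J t h s) ×
      (∀ h → ∃ λ k → ∀ s → Block J t h s ⟺ ColorClass O col k s)

{-# OPTIONS --safe #-}
module Submission where

-- Whenever each g ∈ H permutes the colours, the permutations form an action of H
-- on the m colours making col equivariant; it is transitive because a single orbit
-- X i already shows every colour.  Then J is the stabilizer of the common colour c
-- of chosen tiles tᵢ, its index is m by orbit–stabilizer, and the colour class of
-- h c is exactly h(J t₁ ∪ ⋯ ∪ J tₙ).  Conversely, g maps the block of h into the
-- block of g h, so a partition into such blocks is permuted by H.

open import Defs
open import Level using (0ℓ)
open import Algebra.Bundles using (Group)
open import Data.Nat using (ℕ; _≤_; s≤s)
open import Data.Fin using (Fin; zero)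
open import Data.Product using (Σ; ∃; _×_; _,_; proj₁; proj₂; swap)
open import Relation.Binary.PropositionalEquality
  using (_≡_; _≢_; refl; sym; trans; cong; subst; module ≡-Reasoning)
open import Relation.Nullary using (¬_)
open import Function.Definitions using (Injective; Bijective)

module _ {H : Group 0ℓ 0ℓ} where
  open Group H using (Carrier; _≈_; _∙_; ε; _⁻¹; inverseˡ; inverseʳ; assoc; identityˡ; ∙-congʳ)
  module G = Group H
  open ≡-Reasoning

  module ActionProperties {S : Set} (B : Action H S) where
    open Action B

    act-inverseˡ : ∀ g s → act (g ⁻¹) (act g s) ≡ s
    act-inverseˡ g s = begin
      act (g ⁻¹) (act g s) ≡⟨ act-∙ (g ⁻¹) g s ⟨
      act (g ⁻¹ ∙ g) s     ≡⟨ act-≈ s (inverseˡ g) ⟩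
      act ε s              ≡⟨ act-ε s ⟩
      s                    ∎

    act-inverseʳ : ∀ g s → act g (act (g ⁻¹) s) ≡ s
    act-inverseʳ g s = begin
      act g (act (g ⁻¹) s) ≡⟨ act-∙ g (g ⁻¹) s ⟨
      act (g ∙ g ⁻¹) s     ≡⟨ act-≈ s (inverseʳ g) ⟩
      act ε s              ≡⟨ act-ε s ⟩
      s                    ∎

    act-injective : ∀ g → Injective _≡_ _≡_ (act g)
    act-injective g {x} {y} e = begin
      x                    ≡⟨ act-inverseˡ g x ⟨
      act (g ⁻¹) (act g x) ≡⟨ cong (act (g ⁻¹)) e ⟩
      act (g ⁻¹) (act g y) ≡⟨ act-inverseˡ g y ⟩
      y                    ∎

    act-bijective : ∀ g → Bijective _≡_ _≡_ (act g)
    act-bijective g = act-injective g , λ y → act (g ⁻¹) y , λ { refl → act-inverseʳ g y }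

    Stabilizer : S → Carrier → Set
    Stabilizer s g = act g s ≡ s

    stabilizer-isSubgroup : ∀ s → IsSubgroup H (Stabilizer s)
    stabilizer-isSubgroup s = record
      { resp = λ g≈h gs≡s → trans (sym (act-≈ s g≈h)) gs≡s
      ; ε∈   = act-ε s
      ; ∙∈   = λ {g} {h} gs≡s hs≡s → trans (act-∙ g h s) (trans (cong (act g) hs≡s) gs≡s)
      ; ⁻¹∈  = λ {g} gs≡s → trans (cong (act (g ⁻¹)) (sym gs≡s)) (act-inverseˡ g s)
      }

    orbit-inhabited : ∀ {X} → IsOrbit H B X → ∃ X
    orbit-inhabited (t , X⟺Ht) = t , proj₂ (X⟺Ht t) (ε , act-ε t)

    orbit-closed : ∀ {X} → IsOrbit H B X → ∀ g {s} → X s → X (act g s)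
    orbit-closed (t , X⟺Ht) g {s} Xs with proj₁ (X⟺Ht s) Xs
    ... | h , ht≡s = proj₂ (X⟺Ht (act g s)) (g ∙ h , trans (act-∙ g h t) (cong (act g) ht≡s))

    orbit-connected : ∀ {X} → IsOrbit H B X → ∀ {s u} → X s → X u → ∃ λ a → act a s ≡ u
    orbit-connected (t , X⟺Ht) {s} {u} Xs Xu with proj₁ (X⟺Ht s) Xs | proj₁ (X⟺Ht u) Xu
    ... | h , ht≡s | k , kt≡u = k ∙ h ⁻¹ , (begin
      act (k ∙ h ⁻¹) s             ≡⟨ act-∙ k (h ⁻¹) s ⟩
      act k (act (h ⁻¹) s)         ≡⟨ cong (λ x → act k (act (h ⁻¹) x)) ht≡s ⟨
      act k (act (h ⁻¹) (act h t)) ≡⟨ cong (act k) (act-inverseˡ h t) ⟩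
      act k t                      ≡⟨ kt≡u ⟩
      u                            ∎)

    union-of-orbits-invariant : ∀ {n} {O : S → Set} {X : Fin n → S → Set} →
      (∀ i → IsOrbit H B (X i)) → (∀ s → O s ⟺ (∃ λ i → X i s)) →
      ∀ g {s} → O s → O (act g s)
    union-of-orbits-invariant orbX O⟺X g {s} Os with proj₁ (O⟺X s) Os
    ... | i , Xs = proj₂ (O⟺X (act g s)) (i , orbit-closed (orbX i) g Xs)

  stabilizer-hasIndex : ∀ {m} (B : Action H (Fin m)) (c : Fin m) (r : Fin m → Carrier) →
    (∀ k → Action.act B (r k) c ≡ k) → HasIndex H (ActionProperties.Stabilizer B c) m
  stabilizer-hasIndex B c r rc≡ = r , covers , distinct
    where
    open Action B
    open ActionProperties B
    covers : ∀ h → ∃ λ i → Stabilizer c (r i ⁻¹ ∙ h)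
    covers h = k , (begin
      act (r k ⁻¹ ∙ h) c           ≡⟨ act-∙ (r k ⁻¹) h c ⟩
      act (r k ⁻¹) k               ≡⟨ cong (act (r k ⁻¹)) (rc≡ k) ⟨
      act (r k ⁻¹) (act (r k) c)   ≡⟨ act-inverseˡ (r k) c ⟩
      c                            ∎)
      where k = act h c
    distinct : ∀ i j → Stabilizer c (r i ⁻¹ ∙ r j) → i ≡ j
    distinct i j fixes = begin
      i                                      ≡⟨ rc≡ i ⟨
      act (r i) c                            ≡⟨ cong (act (r i)) fixes ⟨
      act (r i) (act (r i ⁻¹ ∙ r j) c)       ≡⟨ cong (act (r i)) (act-∙ (r i ⁻¹) (r j) c) ⟩
      act (r i) (act (r i ⁻¹) (act (r j) c)) ≡⟨ act-inverseʳ (r i) (act (r j) c) ⟩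
      act (r j) c                            ≡⟨ rc≡ j ⟩
      j                                      ∎

  module InducedAction {T C : Set} (A : Action H T) {O : T → Set}
    (O-invariant : ∀ g {s} → O s → O (Action.act A g s))
    (col : T → C) (col-onto : ∀ k → ∃ λ s → O s × col s ≡ k)
    (π : Carrier → C → C)
    (π-compatible : ∀ g s → O s → col (Action.act A g s) ≡ π g (col s)) where
    open Action A

    colour-elim : (P : C → Set) → (∀ s → O s → P (col s)) → ∀ k → P k
    colour-elim P p k with col-onto k
    ... | s , Os , refl = p s Os

    colourAction : Action H C
    colourAction = record
      { act   = π
      ; act-ε = colour-elim (λ k → π ε k ≡ k) λ s Os →
          trans (sym (π-compatible ε s Os)) (cong col (act-ε s))
      ; act-∙ = λ g h → colour-elim (λ k → π (g ∙ h) k ≡ π g (π h k)) λ s Os → begin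
          π (g ∙ h) (col s)     ≡⟨ π-compatible (g ∙ h) s Os ⟨
          col (act (g ∙ h) s)   ≡⟨ cong col (act-∙ g h s) ⟩
          col (act g (act h s)) ≡⟨ π-compatible g (act h s) (O-invariant h Os) ⟩
          π g (col (act h s))   ≡⟨ cong (π g) (π-compatible h s Os) ⟩
          π g (π h (col s))     ∎
      ; act-≈ = λ {g} {h} k g≈h → colour-elim (λ k → π g k ≡ π h k) (λ s Os → begin
          π g (col s)   ≡⟨ π-compatible g s Os ⟨
          col (act g s) ≡⟨ cong col (act-≈ s g≈h) ⟩
          col (act h s) ≡⟨ π-compatible h s Os ⟩
          π h (col s)   ∎) k
      }

  module _ {T : Set} (A : Action H T) where
    open Action A
    open ActionProperties A

    BlockColouring : ∀ {n m} → (T → Set) → (T → Fin m) → (Fin n → T → Set) → Set₁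
    BlockColouring {n} {m} O col X =
      Σ (Fin n → T) λ t → Σ (Carrier → Set) λ J →
        (∀ i → X i (t i)) ×
        IsSubgroup H J × HasIndex H J m ×
        (∀ i → StabIn H A (t i) J) ×
        PartitionIsBlocks H A O col J t

    block-translate : ∀ {n J} {t : Fin n → T} g {h s} →
      Block H A J t h s → Block H A J t (g ∙ h) (act g s)
    block-translate {t = t} g {h} {s} (i , j , Jj , hjt≡s) = i , j , Jj , (begin
      act (g ∙ h ∙ j) (t i)     ≡⟨ act-≈ (t i) (assoc g h j) ⟩
      act (g ∙ (h ∙ j)) (t i)   ≡⟨ act-∙ g (h ∙ j) (t i) ⟩
      act g (act (h ∙ j) (t i)) ≡⟨ cong (act g) hjt≡s ⟩
      act g s                   ∎)

    blocks⇒permuted : ∀ {n m O} {col : T → Fin m} {J} {t : Fin n → T} →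
      (∀ g {s} → O s → O (act g s)) → (∀ k → ∃ λ s → O s × col s ≡ k) →
      PartitionIsBlocks H A O col J t → ∀ g → ColorsPermutedBy H A O col g
    blocks⇒permuted {O = O} {col} O-invariant col-onto (classIsBlock , blockIsClass) g =
      π g , compatible g , Colours.act-bijective g
      where
      block : Fin _ → Carrier
      block k = proj₁ (classIsBlock k)
      π : Carrier → Fin _ → Fin _
      π g k = proj₁ (blockIsClass (g ∙ block k))
      compatible : ∀ g s → O s → col (act g s) ≡ π g (col s)
      compatible g s Os = proj₂ (proj₁ (proj₂ (blockIsClass (g ∙ block (col s))) (act g s))
        (block-translate g (proj₁ (proj₂ (classIsBlock (col s)) s) (Os , refl))))
      module Colours = ActionProperties
        (InducedAction.colourAction A O-invariant col col-onto π compatible)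

    module FromPermutation {n m} {O : T → Set} {col : T → Fin m} {X : Fin n → T → Set}
      (orbX : ∀ i → IsOrbit H A (X i))
      (O⟺X : ∀ s → O s ⟺ (∃ λ i → X i s))
      (col-onto : ∀ k → ∃ λ s → O s × col s ≡ k)
      (X-onto : ∀ i k → ∃ λ s → X i s × col s ≡ k)
      (i₀ : Fin n)
      (permuted : ∀ g → ColorsPermutedBy H A O col g) where

      O-invariant : ∀ g {s} → O s → O (act g s)
      O-invariant = union-of-orbits-invariant orbX O⟺X

      X⇒O : ∀ {i s} → X i s → O s
      X⇒O {i} {s} Xs = proj₂ (O⟺X s) (i , Xs)

      π : Carrier → Fin m → Fin m
      π g = proj₁ (permuted g)

      compatible : ∀ g s → O s → col (act g s) ≡ π g (col s)
      compatible g = proj₁ (proj₂ (permuted g))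

      colours : Action H (Fin m)
      colours = InducedAction.colourAction A O-invariant col col-onto π compatible
      module C = Action colours
      module CP = ActionProperties colours

      u : T
      u = proj₁ (orbit-inhabited (orbX i₀))

      u∈X : X i₀ u
      u∈X = proj₂ (orbit-inhabited (orbX i₀))

      c : Fin m
      c = col u

      t : Fin n → T
      t i = proj₁ (X-onto i c)

      t∈X : ∀ i → X i (t i)
      t∈X i = proj₁ (proj₂ (X-onto i c))

      col-t : ∀ i → col (t i) ≡ c
      col-t i = proj₂ (proj₂ (X-onto i c))

      J : Carrier → Set
      J = CP.Stabilizer c

      tile-of : Fin m → T
      tile-of k = proj₁ (X-onto i₀ k)

      reaches : ∀ k → ∃ λ r → act r u ≡ tile-of k
      reaches k = orbit-connected (orbX i₀) u∈X (proj₁ (proj₂ (X-onto i₀ k)))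

      representative : Fin m → Carrier
      representative k = proj₁ (reaches k)

      representative-sends : ∀ k → π (representative k) c ≡ k
      representative-sends k = begin
        π r (col u)         ≡⟨ compatible r u (X⇒O u∈X) ⟨
        col (act r u)       ≡⟨ cong col (proj₂ (reaches k)) ⟩
        col (tile-of k)     ≡⟨ proj₂ (proj₂ (X-onto i₀ k)) ⟩
        k                   ∎
        where r = representative k

      stab⊆J : ∀ i → StabIn H A (t i) J
      stab⊆J i g gt≡t = begin
        π g c             ≡⟨ cong (π g) (col-t i) ⟨
        π g (col (t i))   ≡⟨ compatible g (t i) (X⇒O (t∈X i)) ⟨
        col (act g (t i)) ≡⟨ cong col gt≡t ⟩
        col (t i)         ≡⟨ col-t i ⟩
        c                 ∎

      block⟺colourClass : ∀ h s → Block H A J t h s ⟺ ColorClass H A O col (π h c) s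
      block⟺colourClass h s = to , from
        where
        to : Block H A J t h s → ColorClass H A O col (π h c) s
        to (i , j , Jj , hjt≡s) = subst O hjt≡s (O-invariant (h ∙ j) (X⇒O (t∈X i))) , (begin
          col s                   ≡⟨ cong col hjt≡s ⟨
          col (act (h ∙ j) (t i)) ≡⟨ compatible (h ∙ j) (t i) (X⇒O (t∈X i)) ⟩
          π (h ∙ j) (col (t i))   ≡⟨ cong (π (h ∙ j)) (col-t i) ⟩
          π (h ∙ j) c             ≡⟨ C.act-∙ h j c ⟩
          π h (π j c)             ≡⟨ cong (π h) Jj ⟩
          π h c                   ∎)
        from : ColorClass H A O col (π h c) s → Block H A J t h s
        from (Os , cols≡) with proj₁ (O⟺X s) Os
        ... | i , Xs with orbit-connected (orbX i) (t∈X i) Xs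
        ... | a , at≡s = i , h ⁻¹ ∙ a , J[h⁻¹a] , trans (act-≈ (t i) h[h⁻¹a]≈a) at≡s
          where
          h[h⁻¹a]≈a : h ∙ (h ⁻¹ ∙ a) ≈ a
          h[h⁻¹a]≈a = G.trans (G.sym (assoc h (h ⁻¹) a))
            (G.trans (∙-congʳ (inverseʳ h)) (identityˡ a))
          J[h⁻¹a] : π (h ⁻¹ ∙ a) c ≡ c
          J[h⁻¹a] = begin
            π (h ⁻¹ ∙ a) c               ≡⟨ C.act-∙ (h ⁻¹) a c ⟩
            π (h ⁻¹) (π a c)             ≡⟨ cong (λ x → π (h ⁻¹) (π a x)) (col-t i) ⟨
            π (h ⁻¹) (π a (col (t i)))   ≡⟨ cong (π (h ⁻¹)) (compatible a (t i) (X⇒O (t∈X i))) ⟨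
            π (h ⁻¹) (col (act a (t i))) ≡⟨ cong (λ x → π (h ⁻¹) (col x)) at≡s ⟩
            π (h ⁻¹) (col s)             ≡⟨ cong (π (h ⁻¹)) cols≡ ⟩
            π (h ⁻¹) (π h c)             ≡⟨ CP.act-inverseˡ h c ⟩
            c                            ∎

      partition : PartitionIsBlocks H A O col J t
      partition =
        (λ k → representative k ,
           subst (λ k′ → ∀ s → ColorClass H A O col k′ s ⟺ Block H A J t (representative k) s)
             (representative-sends k) (λ s → swap (block⟺colourClass (representative k) s)))
        , (λ h → π h c , block⟺colourClass h)

      blockColouring : BlockColouring O col X
      blockColouring =
        t , J , t∈X , CP.stabilizer-isSubgroup c ,
        stabilizer-hasIndex colours c representative representative-sends ,
        stab⊆J , partition

lemma1p5 : (H : Group 0ℓ 0ℓ) (T : Set) (A : Action H T) →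
    (O : T → Set) (n m : ℕ) → 1 ≤ n →
    (X : Fin n → T → Set) →
    (∀ i → IsOrbit H A (X i)) →
    (∀ i j → i ≢ j → ∀ s → ¬ (X i s × X j s)) →
    (∀ s → O s ⟺ (∃ λ i → X i s)) →
    (col : T → Fin m) →
    (∀ k → ∃ λ s → O s × col s ≡ k) →
    (∀ i k → ∃ λ s → X i s × col s ≡ k) →
    ((∀ h → ColorsPermutedBy H A O col h) ⟺
     (Σ (Fin n → T) λ t → Σ (Group.Carrier H → Set) λ J →
        (∀ i → X i (t i)) ×
        IsSubgroup H J × HasIndex H J m ×
        (∀ i → StabIn H A (t i) J) ×
        PartitionIsBlocks H A O col J t))
lemma1p5 H T A O n m (s≤s _) X orbX _ O⟺X col col-onto X-onto =
  (λ permuted → FromPermutation.blockColouring A orbX O⟺X col-onto X-onto zero permuted) ,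
  (λ (_ , _ , _ , _ , _ , _ , partition) →
     blocks⇒permuted A (ActionProperties.union-of-orbits-invariant A orbX O⟺X) col-onto partition)
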